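{- Let $n$ be a positive integer of the form $n=2\cdot\prod_{i=2}^s p_i^{r_i}$, where the $p_i$ are pairwise distinct primes all different from $2$. Then $$\mathcal{I}(n,2)\ge 2n\cdot\prod_{i=2}^s p_i^{\lfloor r_i/2\rfloor}.$$
   Context: For a positive integer $n$, $\mathbb{Z}_n=\mathbb{Z}/n\mathbb{Z}$. Two points $(u_1,u_2),(v_1,v_2)\in\mathbb{Z}_n^2$ are at integral distance if there exists $d\in\mathbb{Z}_n$ with $(u_1-v_1)^2+(u_2-v_2)^2=d^2$ in $\mathbb{Z}_n$. An integral point set over $\mathbb{Z}_n^2$ is a subset of $\mathbb{Z}_n^2$ whose points are pairwise at integral distance. $\mathcal{I}(n,2)$ denotes the maximum cardinality of an integral point set over $\mathbb{Z}_n^2$. -}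

module Defs where

open import Data.Nat using (ℕ; zero; suc; _+_; _*_; _∸_; _^_; _/_; _%_; _<_; _≤_; NonZero)
open import Data.Nat.Primality using (Prime)
open import Data.Fin using (Fin; toℕ)
open import Data.Product using (_×_; _,_; proj₁; proj₂; ∃-syntax)
open import Data.List using (List; []; _∷_; map; length)
open import Data.Nat.ListAction using (product)
open import Data.List.Relation.Unary.All using (All)
open import Data.List.Relation.Unary.Unique.Propositional using (Unique)
open import Data.List.Relation.Unary.AllPairs using (AllPairs)
open import Data.List.Membership.Propositional using (_∈_)
open import Relation.Binary.PropositionalEquality using (_≡_; _≢_)

Point : ℕ → Set
Point n = Fin n × Fin n

-- Difference a - b in Z_n, represented by the natural number a + n - b
-- (congruent to a - b mod n).
diff : (n : ℕ) → Fin n → Fin n → ℕ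
diff n a b = toℕ a + n ∸ toℕ b

IntegralDistance : (n : ℕ) → .{{NonZero n}} → Point n → Point n → Set
IntegralDistance n (u₁ , u₂) (v₁ , v₂) =
  ∃[ d ] ((diff n u₁ v₁ * diff n u₁ v₁ + diff n u₂ v₂ * diff n u₂ v₂) % n
          ≡ (toℕ {n} d * toℕ d) % n)

IsIntegralPointSet : (n : ℕ) → .{{NonZero n}} → List (Point n) → Set
IsIntegralPointSet n S = Unique S × AllPairs (IntegralDistance n) S

-- "I(n,2) ≥ m": some integral point set over Z_n^2 has at least m points.
-- (I(n,2) is the maximum such cardinality, so this is exactly I(n,2) ≥ m.)
I₂≥ : (n : ℕ) → .{{NonZero n}} → ℕ → Set
I₂≥ n m = ∃[ S ] (IsIntegralPointSet n S × m ≤ length S)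

-- prime-power data: list of pairs (p_i , r_i)
primePowerProduct : List (ℕ × ℕ) → ℕ
primePowerProduct fs = product (map (λ f → proj₁ f ^ proj₂ f) fs)

halfPowerProduct : List (ℕ × ℕ) → ℕ
halfPowerProduct fs = product (map (λ f → proj₁ f ^ (proj₂ f / 2)) fs)

module Submission where

-- Write n = 2q with q = ∏ pᵢ^rᵢ odd, and q = h² s where
-- h = ∏ pᵢ^⌊rᵢ/2⌋ and s = ∏ pᵢ^(rᵢ mod 2).  Put t = h s, so that n = t (2h)
-- and q divides t² = q s.  Consider the "grid"
--     S = { (x , t j) : x ∈ ℤₙ , 0 ≤ j < 2h },
-- which has n · 2h points.  For two points of S the coordinate differences
-- are X (arbitrary) and Y, a multiple of t, so q ∣ Y².  For odd q and
-- q ∣ Y² one has  (X + qY)² ≡ X² + Y²  (mod 2q),  because the cross term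
-- 2qXY vanishes and q²Y² ≡ Y² since q² ≡ 1 (mod 2) and q ∣ Y².  Hence every
-- pair of points of S is at integral distance.

open import Defs
open import Data.Nat using (ℕ; zero; suc; _+_; _*_; _∸_; _^_; _/_; _%_; _<_; _≤_; NonZero; s≤s; ≢-nonZero; ≢-nonZero⁻¹)
open import Data.Nat.Properties
open import Data.Nat.DivMod using (m≡m%n+[m/n]*n; m%n<n; %-distribˡ-*; [m+kn]%n≡m%n)
open import Data.Nat.Divisibility using (_∣_; divides; ∣-trans; *-pres-∣; m%n≡0⇒n∣m)
open import Data.Nat.Primality using (Prime; prime⇒irreducible)
open import Data.Nat.ListAction using (product)
open import Data.Nat.Tactic.RingSolver using (solve-∀)
open import Data.Fin using (Fin; toℕ; fromℕ<)
open import Data.Fin.Properties using (toℕ-fromℕ<; toℕ-injective; toℕ<n)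
open import Data.Product using (_×_; _,_; proj₁; proj₂; ∃-syntax)
open import Data.Sum using (inj₁; inj₂)
open import Data.List using (List; []; _∷_; map; length; cartesianProduct; allFin)
open import Data.List.Properties using (length-map; length-++; length-tabulate)
open import Data.List.Relation.Unary.All using (All) renaming (universal to All-universal)
open import Data.List.Relation.Unary.AllPairs using (AllPairs; []; _∷_)
import Data.List.Relation.Unary.AllPairs.Properties as AllPairs
open import Data.List.Relation.Unary.Unique.Propositional using (Unique)
import Data.List.Relation.Unary.Unique.Propositional.Properties as Unique
open import Relation.Binary.PropositionalEquality
open import Data.Empty using (⊥-elim)

-- Odd numbers, with the witness e exhibited so that identities involving
-- q = 1 + 2e can be handed to the ring solver.
Odd : ℕ → Set
Odd q = ∃[ e ] q ≡ 1 + 2 * e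

odd-* : ∀ {a b} → Odd a → Odd b → Odd (a * b)
odd-* (e , refl) (f , refl) = e + f + 2 * e * f , expand e f
  where
  expand : ∀ e f → (1 + 2 * e) * (1 + 2 * f) ≡ 1 + 2 * (e + f + 2 * e * f)
  expand = solve-∀

odd-^ : ∀ {a} → Odd a → ∀ k → Odd (a ^ k)
odd-^ odd-a zero    = 0 , refl
odd-^ odd-a (suc k) = odd-* odd-a (odd-^ odd-a k)

-- A prime other than 2 is odd: if 2 ∣ p then 2 = p by irreducibility.
prime≢2⇒odd : ∀ p → Prime p → p ≢ 2 → Odd p
prime≢2⇒odd p p-prime p≢2 with p % 2 in p%2 | m%n<n p 2
... | 0 | _ with prime⇒irreducible p-prime (m%n≡0⇒n∣m p 2 p%2)
...   | inj₁ ()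
...   | inj₂ 2≡p = ⊥-elim (p≢2 (sym 2≡p))
prime≢2⇒odd p p-prime p≢2 | 1 | _ = p / 2 , (begin
  p                 ≡⟨ m≡m%n+[m/n]*n p 2 ⟩
  p % 2 + p / 2 * 2 ≡⟨ cong (_+ p / 2 * 2) p%2 ⟩
  1 + p / 2 * 2     ≡⟨ cong suc (*-comm (p / 2) 2) ⟩
  1 + 2 * (p / 2)   ∎)
  where open ≡-Reasoning
prime≢2⇒odd p p-prime p≢2 | suc (suc _) | s≤s (s≤s ())

primePowerProduct-odd : ∀ fs → All (λ f → Prime (proj₁ f) × proj₁ f ≢ 2 × 1 ≤ proj₂ f) fs →
                        Odd (primePowerProduct fs)
primePowerProduct-odd []             All.[] = 0 , refl
primePowerProduct-odd ((p , r) ∷ fs) ((p-prime , p≢2 , _) All.∷ ps) =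
  odd-* (odd-^ (prime≢2⇒odd p p-prime p≢2) r) (primePowerProduct-odd fs ps)

remainderProduct : List (ℕ × ℕ) → ℕ
remainderProduct fs = product (map (λ f → proj₁ f ^ (proj₂ f % 2)) fs)

pow-split : ∀ p r → p ^ r ≡ p ^ (r / 2) * p ^ (r / 2) * p ^ (r % 2)
pow-split p r = begin
  p ^ r                           ≡⟨ cong (p ^_) (m≡m%n+[m/n]*n r 2) ⟩
  p ^ (r % 2 + r / 2 * 2)         ≡⟨ ^-distribˡ-+-* p (r % 2) (r / 2 * 2) ⟩
  p ^ (r % 2) * p ^ (r / 2 * 2)   ≡⟨ cong (p ^ (r % 2) *_) (sym (^-*-assoc p (r / 2) 2)) ⟩
  p ^ (r % 2) * (p ^ (r / 2)) ^ 2 ≡⟨ rearrange (p ^ (r % 2)) (p ^ (r / 2)) ⟩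
  p ^ (r / 2) * p ^ (r / 2) * p ^ (r % 2) ∎
  where
  open ≡-Reasoning
  rearrange : ∀ a b → a * (b * (b * 1)) ≡ b * b * a
  rearrange = solve-∀

primePowerProduct-split : ∀ fs →
  primePowerProduct fs ≡ halfPowerProduct fs * halfPowerProduct fs * remainderProduct fs
primePowerProduct-split []             = refl
primePowerProduct-split ((p , r) ∷ fs) =
  trans (cong₂ _*_ (pow-split p r) (primePowerProduct-split fs))
        (rearrange (p ^ (r / 2)) (p ^ (r % 2)) (halfPowerProduct fs) (remainderProduct fs))
  where
  rearrange : ∀ b c e f → b * b * c * (e * e * f) ≡ (b * e) * (b * e) * (c * f)
  rearrange = solve-∀

-- The key identity: for q = 1 + 2e and Y² = W q,
--   (X + qY)² = X² + Y² + (XY + e(2 + 2e)W) · 2q.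
-- (Uses q³W − qW = q(q − 1)(q + 1)W = 2q · e(2 + 2e)W.)
shifted-square : ∀ X Y W e → let q = 1 + 2 * e in Y * Y ≡ W * q →
  (X + q * Y) * (X + q * Y) ≡ X * X + Y * Y + (X * Y + e * (2 + 2 * e) * W) * (2 * q)
shifted-square X Y W e Y²≡Wq = begin
  (X + q * Y) * (X + q * Y)                     ≡⟨ expand X Y q ⟩
  X * X + q * q * (Y * Y) + X * Y * (2 * q)     ≡⟨ cong (λ z → X * X + q * q * z + X * Y * (2 * q)) Y²≡Wq ⟩
  X * X + q * q * (W * q) + X * Y * (2 * q)     ≡⟨ reduce X Y W e ⟩
  X * X + W * q + Z * (2 * q)                   ≡⟨ cong (λ z → X * X + z + Z * (2 * q)) (sym Y²≡Wq) ⟩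
  X * X + Y * Y + Z * (2 * q)                   ∎
  where
  open ≡-Reasoning
  q = 1 + 2 * e
  Z = X * Y + e * (2 + 2 * e) * W
  expand : ∀ X Y q → (X + q * Y) * (X + q * Y) ≡ X * X + q * q * (Y * Y) + X * Y * (2 * q)
  expand = solve-∀
  reduce : ∀ X Y W e → let q = 1 + 2 * e in
    X * X + q * q * (W * q) + X * Y * (2 * q) ≡ X * X + W * q + (X * Y + e * (2 + 2 * e) * W) * (2 * q)
  reduce = solve-∀

sum-of-squares-is-square : ∀ n .{{_ : NonZero n}} q X Y → Odd q → n ≡ 2 * q → q ∣ Y * Y →
  (X * X + Y * Y) % n ≡ ((X + q * Y) * (X + q * Y)) % n
sum-of-squares-is-square n q X Y (e , refl) n≡2q (divides W Y²≡Wq) = sym (begin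
  ((X + q * Y) * (X + q * Y)) % n   ≡⟨ cong (_% n) (shifted-square X Y W e Y²≡Wq) ⟩
  (X * X + Y * Y + Z * (2 * q)) % n ≡⟨ cong (λ m → (X * X + Y * Y + Z * m) % n) (sym n≡2q) ⟩
  (X * X + Y * Y + Z * n) % n       ≡⟨ [m+kn]%n≡m%n (X * X + Y * Y) Z n ⟩
  (X * X + Y * Y) % n               ∎)
  where
  open ≡-Reasoning
  Z = X * Y + e * (2 + 2 * e) * W

integral-of-square : ∀ n .{{_ : NonZero n}} (u v : Point n) M →
  let X = diff n (proj₁ u) (proj₁ v); Y = diff n (proj₂ u) (proj₂ v) in
  (X * X + Y * Y) % n ≡ (M * M) % n → IntegralDistance n u v
integral-of-square n u v M sq = fromℕ< (m%n<n M n) , (begin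
  _                             ≡⟨ sq ⟩
  (M * M) % n                   ≡⟨ %-distribˡ-* M M n ⟩
  ((M % n) * (M % n)) % n       ≡⟨ cong (λ z → (z * z) % n) (sym (toℕ-fromℕ< (m%n<n M n))) ⟩
  (toℕ d * toℕ d) % n           ∎)
  where
  open ≡-Reasoning
  d = fromℕ< (m%n<n M n)

allPairs-universal : ∀ {A : Set} {R : A → A → Set} → (∀ x y → R x y) → (xs : List A) → AllPairs R xs
allPairs-universal R-holds []       = []
allPairs-universal R-holds (x ∷ xs) = All-universal (R-holds x) xs ∷ allPairs-universal R-holds xs

length-cartesianProduct : ∀ {A B : Set} (xs : List A) (ys : List B) →
  length (cartesianProduct xs ys) ≡ length xs * length ys
length-cartesianProduct []       ys = refl
length-cartesianProduct (x ∷ xs) ys =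
  trans (length-++ (map (x ,_) ys)) (cong₂ _+_ (length-map _ ys) (length-cartesianProduct xs ys))

length-allFin : ∀ n → length (allFin n) ≡ n
length-allFin n = length-tabulate {n = n} (λ i → i)

factor-nonZero : ∀ n .{{_ : NonZero n}} t L → n ≡ t * L → NonZero t
factor-nonZero n t L n≡tL = ≢-nonZero (λ t≡0 → ≢-nonZero⁻¹ n (trans n≡tL (cong (_* L) t≡0)))

module Grid (n t L : ℕ) .{{_ : NonZero t}} (n≡tL : n ≡ t * L) where

  column-bound : (j : Fin L) → t * toℕ j < n
  column-bound j = subst (t * toℕ j <_) (sym n≡tL) (*-monoʳ-< t (toℕ<n j))

  column : Fin L → Fin n
  column j = fromℕ< (column-bound j)

  column-injective : ∀ {j k} → column j ≡ column k → j ≡ k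
  column-injective {j} {k} eq = toℕ-injective (*-cancelˡ-≡ (toℕ j) (toℕ k) t (begin
    t * toℕ j        ≡⟨ toℕ-fromℕ< (column-bound j) ⟨
    toℕ (column j)   ≡⟨ cong toℕ eq ⟩
    toℕ (column k)   ≡⟨ toℕ-fromℕ< (column-bound k) ⟩
    t * toℕ k        ∎))
    where open ≡-Reasoning

  point : Fin n × Fin L → Point n
  point (x , j) = x , column j

  point-injective : ∀ {a b} → point a ≡ point b → a ≡ b
  point-injective eq = cong₂ _,_ (cong proj₁ eq) (column-injective (cong proj₂ eq))

  grid : List (Point n)
  grid = map point (cartesianProduct (allFin n) (allFin L))

  grid-unique : Unique grid
  grid-unique = Unique.map⁺ point-injective (Unique.cartesianProduct⁺ (Unique.allFin⁺ n) (Unique.allFin⁺ L))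

  grid-length : length grid ≡ n * L
  grid-length = begin
    length grid                                        ≡⟨ length-map point (cartesianProduct (allFin n) (allFin L)) ⟩
    length (cartesianProduct (allFin n) (allFin L))    ≡⟨ length-cartesianProduct (allFin n) (allFin L) ⟩
    length (allFin n) * length (allFin L)              ≡⟨ cong₂ _*_ (length-allFin n) (length-allFin L) ⟩
    n * L                                              ∎
    where open ≡-Reasoning

  column-diff : ∀ j k → t ∣ diff n (column j) (column k)
  column-diff j k = divides (toℕ j + L ∸ toℕ k) (begin
    toℕ (column j) + n ∸ toℕ (column k)   ≡⟨ cong₂ (λ a b → a + n ∸ b) (toℕ-fromℕ< (column-bound j)) (toℕ-fromℕ< (column-bound k)) ⟩
    t * toℕ j + n ∸ t * toℕ k             ≡⟨ cong (λ m → t * toℕ j + m ∸ t * toℕ k) n≡tL ⟩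
    t * toℕ j + t * L ∸ t * toℕ k         ≡⟨ cong (_∸ t * toℕ k) (*-distribˡ-+ t (toℕ j) L) ⟨
    t * (toℕ j + L) ∸ t * toℕ k           ≡⟨ *-distribˡ-∸ t (toℕ j + L) (toℕ k) ⟨
    t * (toℕ j + L ∸ toℕ k)               ≡⟨ *-comm t (toℕ j + L ∸ toℕ k) ⟩
    (toℕ j + L ∸ toℕ k) * t               ∎)
    where open ≡-Reasoning

grid-bound : ∀ n .{{_ : NonZero n}} q t L → Odd q → n ≡ 2 * q → n ≡ t * L → q ∣ t * t → I₂≥ n (n * L)
grid-bound n q t L odd-q n≡2q n≡tL q∣t² = grid , (grid-unique , pairwise) , ≤-reflexive (sym grid-length)
  where
  instance
    t-nonZero : NonZero t
    t-nonZero = factor-nonZero n t L n≡tL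
  open Grid n t L n≡tL

  integral : ∀ a b → IntegralDistance n (point a) (point b)
  integral (x , j) (y , k) = integral-of-square n (point (x , j)) (point (y , k)) (X + q * Y)
    (sum-of-squares-is-square n q X Y odd-q n≡2q (∣-trans q∣t² (*-pres-∣ (column-diff j k) (column-diff j k))))
    where
    X = diff n x y
    Y = diff n (column j) (column k)

  pairwise : AllPairs (IntegralDistance n) grid
  pairwise = AllPairs.map⁺ (allPairs-universal integral (cartesianProduct (allFin n) (allFin L)))

lemma3 : (n : ℕ) → .{{_ : NonZero n}} → (fs : List (ℕ × ℕ)) →
    All (λ f → Prime (proj₁ f) × proj₁ f ≢ 2 × 1 ≤ proj₂ f) fs →
    Unique (map proj₁ fs) →
    n ≡ 2 * primePowerProduct fs →
    I₂≥ n (2 * n * halfPowerProduct fs)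
lemma3 n fs primes _ n≡2q =
  subst (I₂≥ n) (rearrange n h) (grid-bound n q (h * s) (2 * h) (primePowerProduct-odd fs primes) n≡2q n≡tL q∣t²)
  where
  q = primePowerProduct fs
  h = halfPowerProduct fs
  s = remainderProduct fs
  n≡tL : n ≡ h * s * (2 * h)
  n≡tL = trans n≡2q (trans (cong (2 *_) (primePowerProduct-split fs)) (regroup h s))
    where
    regroup : ∀ h s → 2 * (h * h * s) ≡ h * s * (2 * h)
    regroup = solve-∀
  q∣t² : q ∣ h * s * (h * s)
  q∣t² = divides s (trans (regroup h s) (cong (s *_) (sym (primePowerProduct-split fs))))
    where
    regroup : ∀ h s → h * s * (h * s) ≡ s * (h * h * s)
    regroup = solve-∀
  rearrange : ∀ n h → n * (2 * h) ≡ 2 * n * h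
  rearrange = solve-∀
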